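{- For $n \ge 0$ let $a(n)$ be the number of $n$-color compositions of $n$ in which no part has color $2$. Then $a(0)=a(1)=1$, $a(2)=2$, and for all $n \ge 3$, \[ a(n) = 3a(n-1) - 2a(n-2) + a(n-3). \] Moreover, for all $n \ge 0$, \[ a(n) = \sum_{k=0}^{\lfloor n/2 \rfloor} \binom{n+k}{3k}. \]
   Context: An $n$-color composition of a positive integer $n$ is a finite sequence of parts $(\kappa^{(1)}_{c_1}, \ldots, \kappa^{(r)}_{c_r})$, where $\kappa^{(1)}, \ldots, \kappa^{(r)}$ are positive integers with sum $n$ and each part $\kappa^{(j)}$ carries a color $c_j \in \{1, \ldots, \kappa^{(j)}\}$. By convention there is exactly one (empty) composition of $0$. -}

module Defs where

open import Data.Nat using (ℕ; zero; suc; _+_; _≤_; _≡ᵇ_)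
open import Data.Nat.ListAction using (sum)
open import Data.Bool using (T; not)
open import Data.Product using (Σ; _×_; _,_; proj₁)
open import Data.List using (List; map)
open import Data.List.Relation.Unary.All using (All)
open import Relation.Binary.PropositionalEquality using (_≡_)

record Part : Set where
  constructor part
  field
    size     : ℕ
    color    : ℕ
    1≤color  : 1 ≤ color
    color≤size : color ≤ size

open Part public

-- (size is automatically positive since 1 ≤ color ≤ size)

NColorComposition : ℕ → Set
NColorComposition n = Σ (List Part) (λ ps → sum (map size ps) ≡ n)

-- Those in which no part has color 2 (stated with the boolean test so that
-- proofs of the side condition are unique, making counting meaningful).
NoColor2Composition : ℕ → Set
NoColor2Composition n =
  Σ (NColorComposition n) (λ κ → All (λ p → T (not (color p ≡ᵇ 2))) (proj₁ κ))

-- A part of color c ≠ 2 is either (1 + e)₁ or (3 + d + e)₍₃₊d₎.  Removing the first part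
-- of a composition of n + 1 therefore gives a(n + 1) = a₁(n) + a₂(n − 2), where a₁ and a₂
-- are the first and second partial sums of a; eliminating a₁ and a₂ yields the recurrence.
-- The binomial sum satisfies the same recurrence: the third forward difference of
-- m ↦ C(m, j + 3) is C(m, j), which ties the k-th terms of b(n + 3), b(n + 2), b(n + 1), b(n)
-- to the (k − 1)-th term of b(n + 1).  Both sequences start 1, 1, 2.
module Submission where

open import Defs
open import Data.Bool using (T; not)
open import Data.Bool.Properties using (T-irrelevant)
open import Data.Empty using (⊥)
open import Data.Fin using (Fin; zero)
open import Data.Fin.Properties using (+↔⊎; 0↔⊥)
open import Data.List using (List; []; _∷_; map; upTo; applyUpTo)
open import Data.List.Properties using (map-upTo)
open import Data.List.Relation.Unary.All as All using (All; []; _∷_)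
open import Data.List.Relation.Unary.All.Properties using (map⁺)
open import Data.Nat using (ℕ; zero; suc; _+_; _∸_; _*_; _/_; _≤_; _<_; _≡ᵇ_; z≤n; s≤s)
open import Data.Nat.Combinatorics using (_C_; nCk+nC[k+1]≡[n+1]C[k+1]; k>n⇒nCk≡0)
open import Data.Nat.DivMod using (m/n≤m; m*n/n≡m; /-monoˡ-≤)
open import Data.Nat.ListAction using (sum)
open import Data.Nat.Properties
  using ( +-assoc; +-comm; *-comm; *-suc; *-zeroʳ; *-distribˡ-+; +-suc; +-cancelˡ-≡
        ; +-cancelʳ-≡; +-commutativeSemigroup; +-monoˡ-<; suc-injective; ≤-trans; m≤n+m
        ; m≤m+n; m+[n∸m]≡n; m+n∸m≡n; ≰⇒>; <⇒≱; ≤-irrelevant; ≡-irrelevant; module ≤-Reasoning)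
open import Data.Nat.Tactic.RingSolver using (solve-∀)
open import Data.Product using (Σ; _×_; _,_; proj₁)
open import Data.Sum using (_⊎_; inj₁; inj₂)
open import Data.Sum.Algebra using (⊎-cong)
open import Function using (_∘_)
open import Function.Bundles using (_↔_; mk↔ₛ′)
open import Function.Properties.Inverse using (↔-trans; ↔-sym)
open import Relation.Binary.PropositionalEquality
open import Algebra.Properties.CommutativeSemigroup +-commutativeSemigroup using (interchange)

SatisfiesRecurrence : (ℕ → ℕ) → Set
SatisfiesRecurrence f = ∀ n → f (3 + n) + 2 * f (1 + n) ≡ 3 * f (2 + n) + f n

recurrence-unique : ∀ {f g} → SatisfiesRecurrence f → SatisfiesRecurrence g →
                    f 0 ≡ g 0 → f 1 ≡ g 1 → f 2 ≡ g 2 → ∀ n → f n ≡ g n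
recurrence-unique {f} {g} rec-f rec-g eq₀ eq₁ eq₂ = proj₁ ∘ agree
  where
  agree : ∀ n → f n ≡ g n × f (1 + n) ≡ g (1 + n) × f (2 + n) ≡ g (2 + n)
  agree zero = eq₀ , eq₁ , eq₂
  agree (suc n) with agree n
  ... | fn≡gn , f1+n≡g1+n , f2+n≡g2+n =
    f1+n≡g1+n , f2+n≡g2+n , +-cancelʳ-≡ (2 * f (1 + n)) _ _ (begin
      f (3 + n) + 2 * f (1 + n)  ≡⟨ rec-f n ⟩
      3 * f (2 + n) + f n        ≡⟨ cong₂ (λ x y → 3 * x + y) f2+n≡g2+n fn≡gn ⟩
      3 * g (2 + n) + g n        ≡⟨ rec-g n ⟨
      g (3 + n) + 2 * g (1 + n)  ≡⟨ cong (λ x → g (3 + n) + 2 * x) f1+n≡g1+n ⟨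
      g (3 + n) + 2 * f (1 + n)  ∎)
    where open ≡-Reasoning

∑< : ℕ → (ℕ → ℕ) → ℕ
∑< N f = sum (applyUpTo f N)

∑<-cong : ∀ N {f g : ℕ → ℕ} → (∀ k → f k ≡ g k) → ∑< N f ≡ ∑< N g
∑<-cong zero    f≗g = refl
∑<-cong (suc N) f≗g = cong₂ _+_ (f≗g 0) (∑<-cong N (f≗g ∘ suc))

∑<-distrib-+ : ∀ N (f g : ℕ → ℕ) → ∑< N (λ k → f k + g k) ≡ ∑< N f + ∑< N g
∑<-distrib-+ zero    f g = refl
∑<-distrib-+ (suc N) f g =
  trans (cong (f 0 + g 0 +_) (∑<-distrib-+ N (f ∘ suc) (g ∘ suc))) (interchange (f 0) (g 0) _ _)

∑<-distribˡ-* : ∀ N c (f : ℕ → ℕ) → ∑< N (λ k → c * f k) ≡ c * ∑< N f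
∑<-distribˡ-* zero    c f = sym (*-zeroʳ c)
∑<-distribˡ-* (suc N) c f =
  trans (cong (c * f 0 +_) (∑<-distribˡ-* N c (f ∘ suc))) (sym (*-distribˡ-+ c (f 0) _))

∑<-extend : ∀ {N M} (f : ℕ → ℕ) → N ≤ M → (∀ k → N ≤ k → f k ≡ 0) → ∑< N f ≡ ∑< M f
∑<-extend {M = zero}  f z≤n vanish = refl
∑<-extend {M = suc M} f z≤n vanish =
  cong₂ _+_ (sym (vanish 0 z≤n)) (∑<-extend {M = M} (f ∘ suc) z≤n (λ k _ → vanish (suc k) z≤n))
∑<-extend f (s≤s N≤M) vanish =
  cong (f 0 +_) (∑<-extend (f ∘ suc) N≤M (λ k N≤k → vanish (suc k) (s≤s N≤k)))

C-pascal : ∀ m j → suc m C suc j ≡ m C j + m C suc j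
C-pascal m j = sym (nCk+nC[k+1]≡[n+1]C[k+1] m j)

C-pascal² : ∀ m j → (2 + m) C (2 + j) ≡ m C j + 2 * (m C (1 + j)) + m C (2 + j)
C-pascal² m j = begin
  (2 + m) C (2 + j)                                  ≡⟨ C-pascal (1 + m) (1 + j) ⟩
  (1 + m) C (1 + j) + (1 + m) C (2 + j)              ≡⟨ cong₂ _+_ (C-pascal m j) (C-pascal m (1 + j)) ⟩
  m C j + m C (1 + j) + (m C (1 + j) + m C (2 + j))  ≡⟨ collect (m C j) (m C (1 + j)) (m C (2 + j)) ⟩
  m C j + 2 * (m C (1 + j)) + m C (2 + j)            ∎
  where
  open ≡-Reasoning
  collect : ∀ x y z → x + y + (y + z) ≡ x + 2 * y + z
  collect = solve-∀

C-pascal³ : ∀ m j → (3 + m) C (3 + j) ≡ m C j + 3 * (m C (1 + j)) + 3 * (m C (2 + j)) + m C (3 + j)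
C-pascal³ m j = begin
  (3 + m) C (3 + j)                               ≡⟨ C-pascal (2 + m) (2 + j) ⟩
  (2 + m) C (2 + j) + (2 + m) C (3 + j)           ≡⟨ cong₂ _+_ (C-pascal² m j) (C-pascal² m (1 + j)) ⟩
  u₀ + 2 * u₁ + u₂ + (u₁ + 2 * u₂ + u₃)           ≡⟨ collect u₀ u₁ u₂ u₃ ⟩
  u₀ + 3 * u₁ + 3 * u₂ + u₃                       ∎
  where
  open ≡-Reasoning
  u₀ = m C j
  u₁ = m C (1 + j)
  u₂ = m C (2 + j)
  u₃ = m C (3 + j)
  collect : ∀ w x y z → w + 2 * x + y + (x + 2 * y + z) ≡ w + 3 * x + 3 * y + z
  collect = solve-∀

-- Δ³ C(m, 3 + j) = C(m, j) in the variable m, with the negative terms moved across.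
C-third-difference : ∀ m j → (3 + m) C (3 + j) + 3 * ((1 + m) C (3 + j))
                             ≡ 3 * ((2 + m) C (3 + j)) + m C (3 + j) + m C j
C-third-difference m j = begin
  (3 + m) C (3 + j) + 3 * ((1 + m) C (3 + j))
    ≡⟨ cong₂ (λ x y → x + 3 * y) (C-pascal³ m j) (C-pascal m (2 + j)) ⟩
  u₀ + 3 * u₁ + 3 * u₂ + u₃ + 3 * (u₂ + u₃)
    ≡⟨ collect u₀ u₁ u₂ u₃ ⟩
  3 * (u₁ + 2 * u₂ + u₃) + u₃ + u₀
    ≡⟨ cong (λ x → 3 * x + u₃ + u₀) (C-pascal² m (1 + j)) ⟨
  3 * ((2 + m) C (3 + j)) + m C (3 + j) + m C j
    ∎
  where
  open ≡-Reasoning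
  u₀ = m C j
  u₁ = m C (1 + j)
  u₂ = m C (2 + j)
  u₃ = m C (3 + j)
  collect : ∀ w x y z → w + 3 * x + 3 * y + z + 3 * (y + z) ≡ 3 * (x + 2 * y + z) + z + w
  collect = solve-∀

term : ℕ → ℕ → ℕ
term n k = (n + k) C (3 * k)

binomialSum : ℕ → ℕ
binomialSum n = sum (map (term n) (upTo (suc (n / 2))))

lag : (ℕ → ℕ) → ℕ → ℕ
lag f zero    = 0
lag f (suc k) = f k

term-suc : ∀ i n k → term (i + n) (suc k) ≡ (i + (n + suc k)) C (3 + 3 * k)
term-suc i n k = cong₂ _C_ (+-assoc i n (suc k)) (*-suc 3 k)

term-recurrence : ∀ n k → term (3 + n) k + 3 * term (1 + n) k
                          ≡ 3 * term (2 + n) k + term n k + lag (term (1 + n)) k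
term-recurrence n zero    = refl
term-recurrence n (suc k) = begin
  term (3 + n) (suc k) + 3 * term (1 + n) (suc k)
    ≡⟨ cong₂ (λ x y → x + 3 * y) (term-suc 3 n k) (term-suc 1 n k) ⟩
  (3 + m) C (3 + j) + 3 * ((1 + m) C (3 + j))
    ≡⟨ C-third-difference m j ⟩
  3 * ((2 + m) C (3 + j)) + m C (3 + j) + m C j
    ≡⟨ cong₂ _+_ (cong₂ (λ x y → 3 * x + y) (term-suc 2 n k) (term-suc 0 n k))
                 (cong (_C j) (sym (+-suc n k))) ⟨
  3 * term (2 + n) (suc k) + term n (suc k) + term (1 + n) k
    ∎
  where
  open ≡-Reasoning
  m = n + suc k
  j = 3 * k

term-vanishes : ∀ n k → n / 2 < k → term n k ≡ 0
term-vanishes n k n/2<k = k>n⇒nCk≡0 (begin-strict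
  n + k      <⟨ +-monoˡ-< k n<2k ⟩
  2 * k + k  ≡⟨ +-comm (2 * k) k ⟩
  3 * k      ∎)
  where
  open ≤-Reasoning
  n<2k : n < 2 * k
  n<2k = ≰⇒> λ 2k≤n → <⇒≱ n/2<k
    (subst (_≤ n / 2) (trans (cong (_/ 2) (*-comm 2 k)) (m*n/n≡m k 2)) (/-monoˡ-≤ 2 2k≤n))

binomialSum-as-∑< : ∀ j m → binomialSum m ≡ ∑< (suc (j + m)) (term m)
binomialSum-as-∑< j m = begin
  binomialSum m              ≡⟨ cong sum (map-upTo (term m) (suc (m / 2))) ⟩
  ∑< (suc (m / 2)) (term m)  ≡⟨ ∑<-extend (term m) m/2<1+j+m (term-vanishes m) ⟩
  ∑< (suc (j + m)) (term m)  ∎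
  where
  open ≡-Reasoning
  m/2<1+j+m : m / 2 < suc (j + m)
  m/2<1+j+m = s≤s (≤-trans (m/n≤m m 2) (m≤n+m m j))

binomialSum-recurrence : SatisfiesRecurrence binomialSum
binomialSum-recurrence n = +-cancelʳ-≡ (b (1 + n)) _ _ (begin
  b (3 + n) + 2 * b (1 + n) + b (1 + n)
    ≡⟨ trans (+-assoc (b (3 + n)) _ _) (cong (b (3 + n) +_) (+-comm (2 * b (1 + n)) _)) ⟩
  b (3 + n) + 3 * b (1 + n)
    ≡⟨ cong₂ (λ x y → x + 3 * y) (binomialSum-as-∑< 0 (3 + n)) (binomialSum-as-∑< 2 (1 + n)) ⟩
  ∑< M (term (3 + n)) + 3 * ∑< M (term (1 + n))
    ≡⟨ cong (∑< M (term (3 + n)) +_) (∑<-distribˡ-* M 3 (term (1 + n))) ⟨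
  ∑< M (term (3 + n)) + ∑< M (λ k → 3 * term (1 + n) k)
    ≡⟨ ∑<-distrib-+ M (term (3 + n)) (λ k → 3 * term (1 + n) k) ⟨
  ∑< M (λ k → term (3 + n) k + 3 * term (1 + n) k)
    ≡⟨ ∑<-cong M (term-recurrence n) ⟩
  ∑< M (λ k → 3 * term (2 + n) k + term n k + lag (term (1 + n)) k)
    ≡⟨ ∑<-distrib-+ M (λ k → 3 * term (2 + n) k + term n k) (lag (term (1 + n))) ⟩
  ∑< M (λ k → 3 * term (2 + n) k + term n k) + ∑< (3 + n) (term (1 + n))
    ≡⟨ cong (_+ ∑< (3 + n) (term (1 + n))) (∑<-distrib-+ M (λ k → 3 * term (2 + n) k) (term n)) ⟩
  ∑< M (λ k → 3 * term (2 + n) k) + ∑< M (term n) + ∑< (3 + n) (term (1 + n))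
    ≡⟨ cong (λ x → x + ∑< M (term n) + ∑< (3 + n) (term (1 + n))) (∑<-distribˡ-* M 3 (term (2 + n))) ⟩
  3 * ∑< M (term (2 + n)) + ∑< M (term n) + ∑< (3 + n) (term (1 + n))
    ≡⟨ cong₂ _+_ (cong₂ (λ x y → 3 * x + y) (binomialSum-as-∑< 1 (2 + n)) (binomialSum-as-∑< 3 n))
                 (binomialSum-as-∑< 1 (1 + n)) ⟨
  3 * b (2 + n) + b n + b (1 + n)
    ∎)
  where
  open ≡-Reasoning
  b = binomialSum
  M = 4 + n

-- Compositions as words of part codes

Fiber : {A : Set} → (A → ℕ) → ℕ → Set
Fiber {A} w n = Σ A λ x → w x ≡ n

Fiber-≡ : ∀ {A : Set} {w : A → ℕ} {n} {x y : A} {p : w x ≡ n} {q : w y ≡ n} →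
          x ≡ y → _≡_ {A = Fiber w n} (x , p) (y , q)
Fiber-≡ refl = cong (_ ,_) (≡-irrelevant _ _)

-- Fiber (padded w) n is the disjoint union of the Fiber w m with m ≤ n.
padded : {A : Set} → (A → ℕ) → ℕ × A → ℕ
padded w (e , x) = e + w x

Fiber-padded-zero : ∀ {A : Set} (w : A → ℕ) → Fiber (padded w) 0 ↔ Fiber w 0
Fiber-padded-zero w = mk↔ₛ′ to from (λ _ → refl) from-to
  where
  to : Fiber (padded w) 0 → Fiber w 0
  to ((zero , x) , eq) = x , eq
  from : Fiber w 0 → Fiber (padded w) 0
  from (x , eq) = (0 , x) , eq
  from-to : ∀ x → from (to x) ≡ x
  from-to ((zero , _) , _) = refl

Fiber-padded-suc : ∀ {A : Set} (w : A → ℕ) n →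
                   Fiber (padded w) (suc n) ↔ (Fiber w (suc n) ⊎ Fiber (padded w) n)
Fiber-padded-suc w n = mk↔ₛ′ to from to-from from-to
  where
  to : Fiber (padded w) (suc n) → Fiber w (suc n) ⊎ Fiber (padded w) n
  to ((zero , x) , eq)  = inj₁ (x , eq)
  to ((suc e , x) , eq) = inj₂ ((e , x) , suc-injective eq)
  from : Fiber w (suc n) ⊎ Fiber (padded w) n → Fiber (padded w) (suc n)
  from (inj₁ (x , eq))       = (0 , x) , eq
  from (inj₂ ((e , x) , eq)) = (suc e , x) , cong suc eq
  to-from : ∀ y → to (from y) ≡ y
  to-from (inj₁ _) = refl
  to-from (inj₂ _) = cong inj₂ (Fiber-≡ refl)
  from-to : ∀ x → from (to x) ≡ x
  from-to ((zero , _) , _)  = refl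
  from-to ((suc _ , _) , _) = Fiber-≡ refl

Shift₂ : (ℕ → Set) → ℕ → Set
Shift₂ X (suc (suc n)) = X n
Shift₂ X _             = ⊥

data PartCode : Set where
  color1  : (e : ℕ) → PartCode
  color3+ : (d e : ℕ) → PartCode

decode : PartCode → Part
decode (color1 e)    = part (1 + e) 1 (s≤s z≤n) (s≤s z≤n)
decode (color3+ d e) = part (3 + (d + e)) (3 + d) (s≤s z≤n) (s≤s (s≤s (s≤s (m≤m+n d e))))

NotColor2 : Part → Set
NotColor2 p = T (not (color p ≡ᵇ 2))

decode-notColor2 : ∀ c → NotColor2 (decode c)
decode-notColor2 (color1 _)    = _
decode-notColor2 (color3+ _ _) = _

encode : (p : Part) → NotColor2 p → PartCode
encode (part _ zero () _) _
encode (part (suc s) 1 _ (s≤s _)) _ = color1 s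
encode (part _ 2 _ _) ()
encode (part (suc (suc (suc s))) (suc (suc (suc d))) _ (s≤s (s≤s (s≤s _)))) _ = color3+ d (s ∸ d)

Part-≡ : ∀ {p q : Part} → size p ≡ size q → color p ≡ color q → p ≡ q
Part-≡ {part s c _ _} refl refl = cong₂ (part s c) (≤-irrelevant _ _) (≤-irrelevant _ _)

decode-encode : ∀ p ok → decode (encode p ok) ≡ p
decode-encode (part _ zero () _) _
decode-encode (part (suc _) 1 _ (s≤s _)) _ = Part-≡ refl refl
decode-encode (part _ 2 _ _) ()
decode-encode (part (suc (suc (suc _))) (suc (suc (suc d))) _ (s≤s (s≤s (s≤s d≤s)))) _ =
  Part-≡ (cong (3 +_) (m+[n∸m]≡n d≤s)) refl

encode-decode : ∀ c ok → encode (decode c) ok ≡ c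
encode-decode (color1 _)    _ = refl
encode-decode (color3+ d e) _ = cong (color3+ d) (m+n∸m≡n d e)

encodeAll : ∀ ps → All NotColor2 ps → List PartCode
encodeAll []       []         = []
encodeAll (p ∷ ps) (ok ∷ oks) = encode p ok ∷ encodeAll ps oks

decodeAll-encodeAll : ∀ ps oks → map decode (encodeAll ps oks) ≡ ps
decodeAll-encodeAll []       []         = refl
decodeAll-encodeAll (p ∷ ps) (ok ∷ oks) = cong₂ _∷_ (decode-encode p ok) (decodeAll-encodeAll ps oks)

encodeAll-decodeAll : ∀ cs oks → encodeAll (map decode cs) oks ≡ cs
encodeAll-decodeAll []       []         = refl
encodeAll-decodeAll (c ∷ cs) (ok ∷ oks) = cong₂ _∷_ (encode-decode c ok) (encodeAll-decodeAll cs oks)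

NoColor2Composition-≡ : ∀ {n ps qs} {eq eq′ oks oks′} → ps ≡ qs →
                        _≡_ {A = NoColor2Composition n} ((ps , eq) , oks) ((qs , eq′) , oks′)
NoColor2Composition-≡ refl =
  cong₂ (λ eq oks → (_ , eq) , oks) (≡-irrelevant _ _) (All.irrelevant T-irrelevant _ _)

weight : List PartCode → ℕ
weight cs = sum (map size (map decode cs))

NoColor2Composition↔Fiber-weight : ∀ n → NoColor2Composition n ↔ Fiber weight n
NoColor2Composition↔Fiber-weight n = mk↔ₛ′ to from to-from from-to
  where
  to : NoColor2Composition n → Fiber weight n
  to ((ps , eq) , oks) = encodeAll ps oks , trans (cong (sum ∘ map size) (decodeAll-encodeAll ps oks)) eq
  from : Fiber weight n → NoColor2Composition n
  from (cs , eq) = (map decode cs , eq) , map⁺ (All.universal decode-notColor2 cs)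
  to-from : ∀ y → to (from y) ≡ y
  to-from (cs , _) = Fiber-≡ (encodeAll-decodeAll cs _)
  from-to : ∀ x → from (to x) ≡ x
  from-to ((ps , _) , oks) = NoColor2Composition-≡ (decodeAll-encodeAll ps oks)

Fiber-weight-zero : Fiber weight 0 ↔ Fin 1
Fiber-weight-zero = mk↔ₛ′ (λ _ → zero) (λ _ → [] , refl) (λ { zero → refl }) from-to
  where
  from-to : ∀ x → ([] , refl) ≡ x
  from-to ([] , refl)            = refl
  from-to (color1 _ ∷ _ , ())
  from-to (color3+ _ _ ∷ _ , ())

Fiber-weight-suc : ∀ n → Fiber weight (suc n) ↔
                   (Fiber (padded weight) n ⊎ Shift₂ (Fiber (padded (padded weight))) n)
Fiber-weight-suc _ = mk↔ₛ′ to from to-from from-to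
  where
  to : ∀ {n} → Fiber weight (suc n) → Fiber (padded weight) n ⊎ Shift₂ (Fiber (padded (padded weight))) n
  to ([] , ())
  to (color1 e ∷ cs , eq) = inj₁ ((e , cs) , suc-injective eq)
  to {zero}          (color3+ _ _ ∷ _ , ())
  to {suc zero}      (color3+ _ _ ∷ _ , ())
  to {suc (suc _)}   (color3+ d e ∷ cs , eq) =
    inj₂ ((d , e , cs) , trans (sym (+-assoc d e (weight cs))) (+-cancelˡ-≡ 3 _ _ eq))
  from : ∀ {n} → Fiber (padded weight) n ⊎ Shift₂ (Fiber (padded (padded weight))) n → Fiber weight (suc n)
  from (inj₁ ((e , cs) , eq)) = color1 e ∷ cs , cong suc eq
  from {suc (suc _)} (inj₂ ((d , e , cs) , eq)) =
    color3+ d e ∷ cs , cong (3 +_) (trans (+-assoc d e (weight cs)) eq)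
  to-from : ∀ {n} y → to {n} (from y) ≡ y
  to-from (inj₁ _) = cong inj₁ (Fiber-≡ refl)
  to-from {suc (suc _)} (inj₂ _) = cong inj₂ (Fiber-≡ refl)
  from-to : ∀ {n} x → from (to {n} x) ≡ x
  from-to ([] , ())
  from-to (color1 _ ∷ _ , _) = Fiber-≡ refl
  from-to {zero}        (color3+ _ _ ∷ _ , ())
  from-to {suc zero}    (color3+ _ _ ∷ _ , ())
  from-to {suc (suc _)} (color3+ _ _ ∷ _ , _) = Fiber-≡ refl

-- a₁ and a₂ are the first and second partial sums of a; a₂′ n is a₂ (n ∸ 2), except that
-- it vanishes for n < 2.
mutual
  a : ℕ → ℕ
  a zero    = 1
  a (suc n) = a₁ n + a₂′ n

  a₁ : ℕ → ℕ
  a₁ zero    = a zero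
  a₁ (suc n) = a (suc n) + a₁ n

  a₂ : ℕ → ℕ
  a₂ zero    = a₁ zero
  a₂ (suc n) = a₁ (suc n) + a₂ n

  a₂′ : ℕ → ℕ
  a₂′ (suc (suc n)) = a₂ n
  a₂′ _             = 0

mutual
  count : ∀ n → Fiber weight n ↔ Fin (a n)
  count zero    = Fiber-weight-zero
  count (suc n) =
    ↔-trans (Fiber-weight-suc n) (↔-trans (⊎-cong (count₁ n) (count₂′ n)) (↔-sym +↔⊎))

  count₁ : ∀ n → Fiber (padded weight) n ↔ Fin (a₁ n)
  count₁ zero    = ↔-trans (Fiber-padded-zero weight) (count zero)
  count₁ (suc n) =
    ↔-trans (Fiber-padded-suc weight n) (↔-trans (⊎-cong (count (suc n)) (count₁ n)) (↔-sym +↔⊎))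

  count₂ : ∀ n → Fiber (padded (padded weight)) n ↔ Fin (a₂ n)
  count₂ zero    = ↔-trans (Fiber-padded-zero (padded weight)) (count₁ zero)
  count₂ (suc n) =
    ↔-trans (Fiber-padded-suc (padded weight) n) (↔-trans (⊎-cong (count₁ (suc n)) (count₂ n)) (↔-sym +↔⊎))

  count₂′ : ∀ n → Shift₂ (Fiber (padded (padded weight))) n ↔ Fin (a₂′ n)
  count₂′ zero          = ↔-sym 0↔⊥
  count₂′ (suc zero)    = ↔-sym 0↔⊥
  count₂′ (suc (suc n)) = count₂ n

a-4+ : ∀ n → a (4 + n) ≡ 2 * a (3 + n) + a₁ (1 + n)
a-4+ n = regroup (a₁ (2 + n)) (a₂ n) (a₁ (1 + n))
  where
  regroup : ∀ x y z → x + y + x + (z + y) ≡ 2 * (x + y) + z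
  regroup = solve-∀

a-recurrence : SatisfiesRecurrence a
a-recurrence zero          = refl
a-recurrence (suc zero)    = refl
a-recurrence (suc (suc n)) = begin
  a (5 + n) + 2 * a (3 + n)
    ≡⟨ cong (_+ 2 * a (3 + n)) (a-4+ (1 + n)) ⟩
  2 * a (4 + n) + (a (2 + n) + a₁ (1 + n)) + 2 * a (3 + n)
    ≡⟨ regroup (2 * a (4 + n)) (a (2 + n)) (a₁ (1 + n)) (2 * a (3 + n)) ⟩
  2 * a (4 + n) + a (2 + n) + (2 * a (3 + n) + a₁ (1 + n))
    ≡⟨ cong (2 * a (4 + n) + a (2 + n) +_) (a-4+ n) ⟨
  2 * a (4 + n) + a (2 + n) + a (4 + n)
    ≡⟨ collect (a (4 + n)) (a (2 + n)) ⟩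
  3 * a (4 + n) + a (2 + n)
    ∎
  where
  open ≡-Reasoning
  regroup : ∀ x y z w → x + (y + z) + w ≡ x + y + (w + z)
  regroup = solve-∀
  collect : ∀ x y → 2 * x + y + x ≡ 3 * x + y
  collect = solve-∀

proposition12 : Σ (ℕ → ℕ) (λ a →
    ((n : ℕ) → NoColor2Composition n ↔ Fin (a n))
    × a 0 ≡ 1 × a 1 ≡ 1 × a 2 ≡ 2
    × ((n : ℕ) → a (3 + n) + 2 * a (1 + n) ≡ 3 * a (2 + n) + a n)
    × ((n : ℕ) → a n ≡ sum (map (λ k → (n + k) C (3 * k)) (upTo (suc (n / 2))))))
proposition12 =
  a , (λ n → ↔-trans (NoColor2Composition↔Fiber-weight n) (count n)) , refl , refl , refl
    , a-recurrence , recurrence-unique a-recurrence binomialSum-recurrence refl refl refl
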